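{- Let $m\in\mathbb{N}$, $k\in\mathbb{N}$, and let $n_1,\dots,n_m\in\mathbb{N}$ with $n_i\ge 2$ for $1\le i\le m$. The disjoint union of paths $\bigcup_{i=1}^m P_{n_i}$ is $k$-distance magic if and only if $n_i=3$ (for all $i$) and $m=1=k$.
   Context: All graphs are finite, simple and undirected; $d(u,v)$ is graph distance ($\infty$ between different components). For $u\in V(G)$ and $k\in\mathbb{N}$, $\partial N_k(u)=\{v\in V(G): d(u,v)=k\}$. For a graph $G$ of order $n\ge3$, a $k$-distance magic labeling ($k$-DML) is a bijection $f:V(G)\to\{1,\dots,n\}$ together with a constant $M$ such that $\sum_{w\in\partial N_k(u)} f(w)=M$ for every vertex $u$ with $\partial N_k(u)\neq\emptyset$; moreover $G$ is required to contain at least one pair of vertices at distance $k$. $G$ is $k$-distance magic ($k$-DM) if it has a $k$-DML. -}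

module Defs where

open import Data.Nat using (ℕ; zero; suc; _≤_; _≡ᵇ_; _<ᵇ_; _∸_; _+_)
open import Data.Bool using (Bool; true; false; _∧_; _∨_; not; if_then_else_; T)
open import Data.Bool.Properties using (∨-comm)
open import Data.Fin using (Fin; toℕ)
open import Data.List using (List; []; _∷_; map; allFin)
open import Data.Bool.ListAction using (any)
open import Data.Nat.ListAction using (sum)
open import Data.Product using (Σ; ∃; _×_; _,_)
open import Function.Definitions using (Bijective)
open import Relation.Binary.PropositionalEquality using (_≡_; refl)

record Graph : Set where
  field
    order : ℕ
    adj   : Fin order → Fin order → Bool
    adj-sym   : ∀ u v → adj u v ≡ adj v u
    adj-irref : ∀ u → adj u u ≡ false
open Graph public

within : (G : Graph) → ℕ → Fin (order G) → Fin (order G) → Bool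
within G zero    u v = toℕ u ≡ᵇ toℕ v
within G (suc j) u v =
  within G j u v ∨ any (λ w → within G j u w ∧ adj G w v) (allFin (order G))

-- atDist G k u v : d(u,v) = k  (graph distance; false if in different components)
atDist : (G : Graph) → ℕ → Fin (order G) → Fin (order G) → Bool
atDist G zero    u v = within G zero u v
atDist G (suc k) u v = within G (suc k) u v ∧ not (within G k u v)

sphereSum : (G : Graph) → (Fin (order G) → ℕ) → ℕ → Fin (order G) → ℕ
sphereSum G ℓ k u =
  sum (map (λ w → if atDist G k u w then ℓ w else 0) (allFin (order G)))

-- k-distance magic labeling: a bijection f : V → {1,…,n} (encoded as
-- v ↦ toℕ (f v) + 1 with f : Fin n → Fin n bijective) and a constant M.
IsKDML : (G : Graph) → ℕ → (Fin (order G) → Fin (order G)) → ℕ → Set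
IsKDML G k f M =
  Bijective _≡_ _≡_ f ×
  (∀ u → (∃ λ w → T (atDist G k u w)) →
     sphereSum G (λ w → suc (toℕ (f w))) k u ≡ M)

KDM : Graph → ℕ → Set
KDM G k =
  3 ≤ order G ×
  (∃ λ u → ∃ λ v → T (atDist G k u v)) ×
  (Σ (Fin (order G) → Fin (order G)) λ f → ∃ λ M → IsKDML G k f M)

-- Vertices are 0 … (n_1+…+n_m) - 1 laid out block by
-- block; p and p+1 are adjacent unless p+1 starts a new block.

blockStart : List ℕ → ℕ → Bool
blockStart []       p = false
blockStart (n ∷ ns) p =
  if p ≡ᵇ 0 then true else (if p <ᵇ n then false else blockStart ns (p ∸ n))

pathStep : (ns : List ℕ) → Fin (sum ns) → Fin (sum ns) → Bool
pathStep ns u v = (suc (toℕ u) ≡ᵇ toℕ v) ∧ not (blockStart ns (toℕ v))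

private
  suc≢ᵇ : ∀ n → (suc n ≡ᵇ n) ≡ false
  suc≢ᵇ zero    = refl
  suc≢ᵇ (suc n) = suc≢ᵇ n

pathsUnion : List ℕ → Graph
pathsUnion ns = record
  { order = sum ns
  ; adj = λ u v → pathStep ns u v ∨ pathStep ns v u
  ; adj-sym = λ u v → ∨-comm (pathStep ns u v) (pathStep ns v u)
  ; adj-irref = λ u → irr u
  }
  where
  irr : ∀ u → (pathStep ns u u ∨ pathStep ns u u) ≡ false
  irr u rewrite suc≢ᵇ (toℕ u) = refl

module Submission where

-- If the sphere ∂N_k(x) is a single vertex w, the magic constant is the label of w; labels
-- being distinct, all vertices whose k-sphere is a singleton share the same partner w.
-- For k = 0 every sphere is a singleton, which is absurd.  For k ≥ 1, take a component
-- P_n with n > k, vertices a_0 … a_{n-1}: a_0 sees only a_k and a_{n-1} sees only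
-- a_{n-1-k}, so n = 2k + 1.  If k ≥ 2, a_1 sees only a_{k+1} ≠ a_k.  If k = 1, the first
-- vertices of two components would have different partners, so the graph is P_3, and
-- the labels 1, 3, 2 along P_3 are 1-distance magic.

open import Defs
open import Data.Bool using (Bool; true; false; T; not; _∧_; if_then_else_)
open import Data.Bool.ListAction using (any)
open import Data.Bool.Properties using (T-∨; T-∧; T-not-≡)
open import Data.Empty using (⊥; ⊥-elim)
open import Data.Fin using (Fin; toℕ; fromℕ<) renaming (zero to fzero; suc to fsuc)
open import Data.Fin.Properties using (toℕ-fromℕ<; toℕ-injective; toℕ<n)
  renaming (suc-injective to fsuc-injective)
open import Data.List using (List; []; _∷_; length; allFin; map; tabulate)
open import Data.List.Properties using (map-tabulate)
open import Data.List.Relation.Unary.All using (All; []; _∷_)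
import Data.List.Relation.Unary.All as All
import Data.List.Relation.Unary.Any as Any
open import Data.List.Relation.Unary.Any.Properties using (any⁺; any⁻)
open import Data.List.Membership.Propositional.Properties using (∈-allFin)
open import Data.Nat using (ℕ; zero; suc; _+_; _≤_; _<_; _<ᵇ_; _≡ᵇ_; z≤n; s≤s; z<s; ∣_-_∣)
open import Data.Nat.ListAction using (sum)
open import Data.Nat.Properties
open import Data.Product using (∃; ∃₂; _×_; _,_; proj₁; proj₂)
open import Data.Sum using (_⊎_; inj₁; inj₂; [_,_]′)
open import Function.Base using (id; _∘_)
open import Function.Bundles using (_⇔_; mk⇔; Equivalence)
open import Function.Consequences.Propositional
  using (inverseᵇ⇒bijective; strictlyInverseˡ⇒inverseˡ; strictlyInverseʳ⇒inverseʳ)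
open import Function.Definitions using (Bijective)
open import Relation.Nullary using (¬_; yes; no)
open import Relation.Binary.PropositionalEquality

open Equivalence

∣m-n∣≡k⇔ : ∀ {m n k} → ∣ m - n ∣ ≡ k ⇔ (m + k ≡ n ⊎ n + k ≡ m)
∣m-n∣≡k⇔ {m} {n} {k} = mk⇔ apart distance
  where
  apart : ∣ m - n ∣ ≡ k → m + k ≡ n ⊎ n + k ≡ m
  apart refl with ≤-total m n
  ... | inj₁ m≤n = inj₁ (trans (cong (m +_) (m≤n⇒∣m-n∣≡n∸m m≤n)) (m+[n∸m]≡n m≤n))
  ... | inj₂ n≤m = inj₂ (trans (cong (n +_) (m≤n⇒∣n-m∣≡n∸m n≤m)) (m+[n∸m]≡n n≤m))
  distance : m + k ≡ n ⊎ n + k ≡ m → ∣ m - n ∣ ≡ k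
  distance (inj₁ refl) = ∣m-m+n∣≡n m k
  distance (inj₂ refl) = trans (∣-∣-comm (n + k) n) (∣m-m+n∣≡n n k)

∣-∣<-interval : ∀ {a n x y} → a ≤ x → x < a + n → a ≤ y → y < a + n → ∣ x - y ∣ < n
∣-∣<-interval {a} {n} {x} {y} a≤x x< a≤y y< =
  [ (λ x+k≡y → gap a≤x (subst (_< a + n) (sym x+k≡y) y<))
  , (λ y+k≡x → gap a≤y (subst (_< a + n) (sym y+k≡x) x<))
  ]′ (to (∣m-n∣≡k⇔ {x} {y}) refl)
  where
  gap : ∀ {z k} → a ≤ z → z + k < a + n → k < n
  gap {z} {k} a≤z z+k< = +-cancelˡ-< a k n (≤-<-trans (+-monoˡ-≤ k a≤z) z+k<)

sum-tabulate-zero : ∀ {n} (g : Fin n → ℕ) → (∀ i → g i ≡ 0) → sum (tabulate g) ≡ 0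
sum-tabulate-zero {zero}  g g≡0 = refl
sum-tabulate-zero {suc n} g g≡0 =
  cong₂ _+_ (g≡0 fzero) (sum-tabulate-zero (g ∘ fsuc) (g≡0 ∘ fsuc))

sum-tabulate-single : ∀ {n} (g : Fin n → ℕ) i₀ → (∀ i → i ≢ i₀ → g i ≡ 0) →
                      sum (tabulate g) ≡ g i₀
sum-tabulate-single g fzero g≡0 =
  trans (cong (g fzero +_) (sum-tabulate-zero (g ∘ fsuc) (λ i → g≡0 (fsuc i) λ ())))
        (+-identityʳ _)
sum-tabulate-single g (fsuc i₀) g≡0 =
  cong₂ _+_ (g≡0 fzero λ ())
            (sum-tabulate-single (g ∘ fsuc) i₀ (λ i i≢i₀ → g≡0 (fsuc i) (i≢i₀ ∘ fsuc-injective)))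

sum-allFin-indicator : ∀ {n} (P : Fin n → Bool) (g : Fin n → ℕ) i₀ → (∀ i → T (P i) ⇔ i ≡ i₀) →
                       sum (map (λ i → if P i then g i else 0) (allFin n)) ≡ g i₀
sum-allFin-indicator {n} P g i₀ P⇔ = begin
  sum (map h (allFin n))  ≡⟨ cong sum (map-tabulate id h) ⟩
  sum (tabulate h)        ≡⟨ sum-tabulate-single h i₀ (λ i i≢i₀ → off (i≢i₀ ∘ to (P⇔ i))) ⟩
  h i₀                    ≡⟨ on (from (P⇔ i₀) refl) ⟩
  g i₀                    ∎
  where
  open ≡-Reasoning
  h : Fin n → ℕ
  h i = if P i then g i else 0
  on : ∀ {b m} → T b → (if b then m else 0) ≡ m
  on {true} _ = refl
  off : ∀ {b m} → ¬ T b → (if b then m else 0) ≡ 0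
  off {true}  ¬t = ⊥-elim (¬t _)
  off {false} _  = refl

any-allFin⇔ : ∀ {n} (P : Fin n → Bool) → T (any P (allFin n)) ⇔ ∃ λ w → T (P w)
any-allFin⇔ {n} P = mk⇔ (λ t → Any.satisfied (any⁻ P (allFin n) t))
                    (λ (w , pw) → any⁺ P (Any.map (λ { refl → pw }) (∈-allFin w)))

allEqual∧length≡1⇔ : ∀ {ns : List ℕ} {m} → (All (_≡ m) ns × length ns ≡ 1) ⇔ ns ≡ m ∷ []
allEqual∧length≡1⇔ {m ∷ []}     = mk⇔ (λ { (refl ∷ [] , _) → refl }) (λ { refl → refl ∷ [] , refl })
allEqual∧length≡1⇔ {[]}         = mk⇔ (λ { (_ , ()) }) (λ ())
allEqual∧length≡1⇔ {_ ∷ _ ∷ _}  = mk⇔ (λ { (_ , ()) }) (λ ())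

-- Blocks of the vertex numbering

blockIndex : List ℕ → ℕ → ℕ
blockIndex ns zero    = 0
blockIndex ns (suc p) =
  if blockStart ns (suc p) then suc (blockIndex ns p) else blockIndex ns p

SameBlock : List ℕ → ℕ → ℕ → Set
SameBlock ns x y = blockIndex ns x ≡ blockIndex ns y

blockIndex-≤-suc : ∀ ns p → blockIndex ns p ≤ blockIndex ns (suc p)
blockIndex-≤-suc ns p with blockStart ns (suc p)
... | true  = n≤1+n _
... | false = ≤-refl

blockIndex-mono : ∀ ns {p q} → p ≤ q → blockIndex ns p ≤ blockIndex ns q
blockIndex-mono ns {q = zero}  z≤n = ≤-refl
blockIndex-mono ns {q = suc q} p≤1+q with m≤n⇒m<n∨m≡n p≤1+q
... | inj₁ (s≤s p≤q) = ≤-trans (blockIndex-mono ns p≤q) (blockIndex-≤-suc ns q)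
... | inj₂ refl      = ≤-refl

sameBlock-between : ∀ ns {p q r} → p ≤ q → q ≤ r → SameBlock ns p r → SameBlock ns p q
sameBlock-between ns p≤q q≤r p~r =
  ≤-antisym (blockIndex-mono ns p≤q) (subst (_ ≤_) (sym p~r) (blockIndex-mono ns q≤r))

blockStart≡false⇔sameBlock : ∀ ns p → blockStart ns (suc p) ≡ false ⇔ SameBlock ns p (suc p)
blockStart≡false⇔sameBlock ns p with blockStart ns (suc p)
... | true  = mk⇔ (λ ()) (λ eq → ⊥-elim (1+n≢n (sym eq)))
... | false = mk⇔ (λ _ → refl) (λ _ → refl)

m+n<ᵇm≡false : ∀ m n → (m + n <ᵇ m) ≡ false
m+n<ᵇm≡false zero    n = refl
m+n<ᵇm≡false (suc m) n = m+n<ᵇm≡false m n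

blockStart-shift : ∀ m ns x → 0 < m → blockStart (m ∷ ns) (m + x) ≡ blockStart ns x
blockStart-shift (suc m) ns x _ rewrite m+n<ᵇm≡false (suc m) x | m+n∸m≡n (suc m) x = refl

blockIndex-head : ∀ m ns {p} → p < m → blockIndex (m ∷ ns) p ≡ 0
blockIndex-head m ns {zero}  _   = refl
blockIndex-head m ns {suc p} p<m with suc p <ᵇ m | <⇒<ᵇ p<m
... | true  | _ = blockIndex-head m ns (<-trans (n<1+n p) p<m)
... | false | ()

blockIndex-step : ∀ ns ns' {p q} → blockStart ns (suc p) ≡ blockStart ns' (suc q) →
                  blockIndex ns p ≡ suc (blockIndex ns' q) →
                  blockIndex ns (suc p) ≡ suc (blockIndex ns' (suc q))
blockIndex-step ns ns' {p} {q} same shifted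
  with blockStart ns (suc p) | blockStart ns' (suc q) | same
... | true  | true  | refl = cong suc shifted
... | false | false | refl = shifted

blockIndex-start : ∀ ns {p} → blockStart ns (suc p) ≡ true →
                   blockIndex ns (suc p) ≡ suc (blockIndex ns p)
blockIndex-start ns {p} start with blockStart ns (suc p) | start
... | true | refl = refl

blockIndex-tail : ∀ m ns {x} → 0 < m → x < sum ns →
                  blockIndex (m ∷ ns) (m + x) ≡ suc (blockIndex ns x)
blockIndex-tail (suc m) (n ∷ ns) {zero} m>0 _ =
  trans (blockIndex-start (suc m ∷ n ∷ ns) (blockStart-shift (suc m) (n ∷ ns) 0 m>0))
        (cong suc (blockIndex-head (suc m) (n ∷ ns) (s≤s (≤-reflexive (+-identityʳ m)))))
blockIndex-tail m ns {suc x} m>0 x< = begin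
  blockIndex (m ∷ ns) (m + suc x)    ≡⟨ cong (blockIndex (m ∷ ns)) (+-suc m x) ⟩
  blockIndex (m ∷ ns) (suc (m + x))  ≡⟨ blockIndex-step (m ∷ ns) ns
                                          (trans (cong (blockStart (m ∷ ns)) (sym (+-suc m x)))
                                                 (blockStart-shift m ns (suc x) m>0))
                                          (blockIndex-tail m ns m>0 (<-trans (n<1+n x) x<)) ⟩
  suc (blockIndex ns (suc x))        ∎
  where open ≡-Reasoning

data Position (m : ℕ) (ns : List ℕ) : ℕ → Set where
  head : ∀ {y} → y < m → Position m ns y
  tail : ∀ {x} → x < sum ns → Position m ns (m + x)

position : ∀ m ns {y} → y < m + sum ns → Position m ns y
position m ns {y} y< with y <? m
... | yes y<m = head y<m
... | no  y≮m = subst (Position m ns) (m+[n∸m]≡n m≤y)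
                  (tail (+-cancelˡ-< m _ _ (subst (_< m + sum ns) (sym (m+[n∸m]≡n m≤y)) y<)))
  where
  m≤y : m ≤ y
  m≤y = ≮⇒≥ y≮m

record Block (ns : List ℕ) (a n : ℕ) : Set where
  field
    nonempty : 0 < n
    bounded  : a + n ≤ sum ns
    members  : ∀ {y} → y < sum ns → SameBlock ns y a ⇔ (a ≤ y × y < a + n)

  start<sum : a < sum ns
  start<sum = <-≤-trans (m<m+n a nonempty) bounded

firstBlock : ∀ m ns → 0 < m → Block (m ∷ ns) 0 m
firstBlock m ns m>0 = record
  { nonempty = m>0
  ; bounded  = m≤m+n m (sum ns)
  ; members  = λ y< → members (position m ns y<)
  }
  where
  members : ∀ {y} → Position m ns y → SameBlock (m ∷ ns) y 0 ⇔ (0 ≤ y × y < m)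
  members (head y<m) = mk⇔ (λ _ → z≤n , y<m) (λ _ → blockIndex-head m ns y<m)
  members (tail x<)  = mk⇔ (λ eq → ⊥-elim (1+n≢0 (trans (sym (blockIndex-tail m ns m>0 x<)) eq)))
                           (λ (_ , m+x<m) → ⊥-elim (m+n≮m m _ m+x<m))

shiftBlock : ∀ m {ns a n} → 0 < m → Block ns a n → Block (m ∷ ns) (m + a) n
shiftBlock m {ns} {a} {n} m>0 B = record
  { nonempty = nonempty
  ; bounded  = subst (_≤ m + sum ns) (sym (+-assoc m a n)) (+-monoʳ-≤ m bounded)
  ; members  = λ y< → members′ (position m ns y<)
  }
  where
  open Block B
  index-a : blockIndex (m ∷ ns) (m + a) ≡ suc (blockIndex ns a)
  index-a = blockIndex-tail m ns m>0 start<sum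
  members′ : ∀ {y} → Position m ns y →
             SameBlock (m ∷ ns) y (m + a) ⇔ (m + a ≤ y × y < m + a + n)
  members′ (head y<m) =
    mk⇔ (λ eq → ⊥-elim (0≢1+n (trans (sym (blockIndex-head m ns y<m)) (trans eq index-a))))
        (λ (m+a≤y , _) → ⊥-elim (m+n≮m m a (≤-<-trans m+a≤y y<m)))
  members′ (tail {x} x<) = mk⇔ inside sameBlock
    where
    index-x : blockIndex (m ∷ ns) (m + x) ≡ suc (blockIndex ns x)
    index-x = blockIndex-tail m ns m>0 x<
    inside : SameBlock (m ∷ ns) (m + x) (m + a) → m + a ≤ m + x × m + x < m + a + n
    inside eq with to (members x<) (suc-injective (trans (sym index-x) (trans eq index-a)))
    ... | a≤x , x<a+n =
      +-monoʳ-≤ m a≤x , subst (m + x <_) (sym (+-assoc m a n)) (+-monoʳ-< m x<a+n)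
    sameBlock : m + a ≤ m + x × m + x < m + a + n → SameBlock (m ∷ ns) (m + x) (m + a)
    sameBlock (m+a≤m+x , m+x<) =
      trans index-x (trans (cong suc (from (members x<) (a≤x , x<a+n))) (sym index-a))
      where
      a≤x   = +-cancelˡ-≤ m a x m+a≤m+x
      x<a+n = +-cancelˡ-< m x (a + n) (subst (m + x <_) (+-assoc m a n) m+x<)

blockOf : ∀ {ns} → All (0 <_) ns → ∀ {p} → p < sum ns →
          ∃₂ λ a n → Block ns a n × a ≤ p × p < a + n
blockOf {m ∷ ns} (m>0 ∷ pos) p< with position m ns p<
... | head p<m = 0 , m , firstBlock m ns m>0 , z≤n , p<m
... | tail {x} x< with blockOf pos x<
...   | a , n , B , a≤x , x<a+n =
  m + a , n , shiftBlock m m>0 B , +-monoʳ-≤ m a≤x ,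
  subst (m + x <_) (sym (+-assoc m a n)) (+-monoʳ-< m x<a+n)

-- Distances in a union of paths

AtDistance : List ℕ → ℕ → ℕ → ℕ → Set
AtDistance ns k x y = SameBlock ns x y × ∣ x - y ∣ ≡ k

WithinDistance : List ℕ → ℕ → ℕ → ℕ → Set
WithinDistance ns j x y = SameBlock ns x y × ∣ x - y ∣ ≤ j

successor⇔ : ∀ ns x y →
             T ((suc x ≡ᵇ y) ∧ not (blockStart ns y)) ⇔ (suc x ≡ y × SameBlock ns x y)
successor⇔ ns x y = mk⇔ forth back
  where
  forth : T ((suc x ≡ᵇ y) ∧ not (blockStart ns y)) → suc x ≡ y × SameBlock ns x y
  forth t with to T-∧ t
  ... | t₁ , t₂ with ≡ᵇ⇒≡ (suc x) y t₁
  ... | refl = refl , to (blockStart≡false⇔sameBlock ns x) (to T-not-≡ t₂)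
  back : suc x ≡ y × SameBlock ns x y → T ((suc x ≡ᵇ y) ∧ not (blockStart ns y))
  back (refl , same) =
    from T-∧ (≡⇒≡ᵇ (suc x) (suc x) refl ,
              from T-not-≡ (from (blockStart≡false⇔sameBlock ns x) same))

adj-pathsUnion : ∀ ns (v w : Fin (sum ns)) →
                 T (adj (pathsUnion ns) v w) ⇔ AtDistance ns 1 (toℕ v) (toℕ w)
adj-pathsUnion ns v w = mk⇔ forth back
  where
  x y : ℕ
  x = toℕ v
  y = toℕ w
  forth : T (adj (pathsUnion ns) v w) → AtDistance ns 1 x y
  forth t with to T-∨ t
  ... | inj₁ t₁ = let (e , same) = to (successor⇔ ns x y) t₁
                  in same , from ∣m-n∣≡k⇔ (inj₁ (trans (+-comm x 1) e))
  ... | inj₂ t₂ = let (e , same) = to (successor⇔ ns y x) t₂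
                  in sym same , from ∣m-n∣≡k⇔ (inj₂ (trans (+-comm y 1) e))
  back : AtDistance ns 1 x y → T (adj (pathsUnion ns) v w)
  back (same , d) with to ∣m-n∣≡k⇔ d
  ... | inj₁ e = from T-∨ (inj₁ (from (successor⇔ ns x y) (trans (+-comm 1 x) e , same)))
  ... | inj₂ e = from T-∨ (inj₂ (from (successor⇔ ns y x) (trans (+-comm 1 y) e , sym same)))

atDistance-split : ∀ ns {x y j} → AtDistance ns (suc j) x y →
                   ∃ λ w → (w ≤ x ⊎ w ≤ y) × AtDistance ns j x w × AtDistance ns 1 w y
atDistance-split ns {x} {y} {j} (x~y , d) with to (∣m-n∣≡k⇔ {x} {y}) d
... | inj₁ refl =
  x + j , inj₂ w≤y , (x~w , ∣m-m+n∣≡n x j) ,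
  (trans (sym x~w) x~y , from ∣m-n∣≡k⇔ (inj₁ (trans (+-assoc x j 1) (cong (x +_) (+-comm j 1)))))
  where
  w≤y : x + j ≤ x + suc j
  w≤y = +-monoʳ-≤ x (n≤1+n j)
  x~w : SameBlock ns x (x + j)
  x~w = sameBlock-between ns (m≤m+n x j) w≤y x~y
... | inj₂ refl =
  y + 1 , inj₁ w≤x , (trans x~y y~w , from ∣m-n∣≡k⇔ (inj₂ (+-assoc y 1 j))) ,
  (sym y~w , from (∣m-n∣≡k⇔ {y + 1} {y}) (inj₂ refl))
  where
  w≤x : y + 1 ≤ y + suc j
  w≤x = +-monoʳ-≤ y (s≤s z≤n)
  y~w : SameBlock ns y (y + 1)
  y~w = sameBlock-between ns (m≤m+n y 1) w≤x (sym x~y)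

withinDistance-extend : ∀ ns {x w y j} → WithinDistance ns j x w → AtDistance ns 1 w y →
                        WithinDistance ns (suc j) x y
withinDistance-extend ns {x} {w} {y} {j} (x~w , d₁) (w~y , d₂) = trans x~w w~y , (begin
  ∣ x - y ∣              ≤⟨ ∣-∣-triangle x w y ⟩
  ∣ x - w ∣ + ∣ w - y ∣  ≤⟨ +-mono-≤ d₁ (≤-reflexive d₂) ⟩
  j + 1                  ≡⟨ +-comm j 1 ⟩
  suc j                  ∎)
  where open ≤-Reasoning

within-pathsUnion : ∀ ns j (u v : Fin (sum ns)) →
                    T (within (pathsUnion ns) j u v) ⇔ WithinDistance ns j (toℕ u) (toℕ v)
within-pathsUnion ns zero u v = mk⇔ forth back
  where
  forth : T (toℕ u ≡ᵇ toℕ v) → WithinDistance ns 0 (toℕ u) (toℕ v)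
  forth t with ≡ᵇ⇒≡ (toℕ u) (toℕ v) t
  ... | eq = cong (blockIndex ns) eq , ≤-reflexive (m≡n⇒∣m-n∣≡0 eq)
  back : WithinDistance ns 0 (toℕ u) (toℕ v) → T (toℕ u ≡ᵇ toℕ v)
  back (_ , d) = ≡⇒≡ᵇ (toℕ u) (toℕ v) (∣m-n∣≡0⇒m≡n (n≤0⇒n≡0 d))
within-pathsUnion ns (suc j) u v = mk⇔ forth back
  where
  G : Graph
  G = pathsUnion ns
  x y : ℕ
  x = toℕ u
  y = toℕ v
  w<sum : ∀ {w} → w ≤ x ⊎ w ≤ y → w < sum ns
  w<sum (inj₁ w≤x) = ≤-<-trans w≤x (toℕ<n u)
  w<sum (inj₂ w≤y) = ≤-<-trans w≤y (toℕ<n v)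
  forth : T (within G (suc j) u v) → WithinDistance ns (suc j) x y
  forth t with to T-∨ t
  ... | inj₁ near = let (x~y , d) = to (within-pathsUnion ns j u v) near
                    in x~y , ≤-trans d (n≤1+n j)
  ... | inj₂ path with to (any-allFin⇔ _) path
  ...   | w , t′ = let (near , edge) = to T-∧ t′ in
    withinDistance-extend ns {x} {toℕ w} (to (within-pathsUnion ns j u w) near)
                                         (to (adj-pathsUnion ns w v) edge)
  back : WithinDistance ns (suc j) x y → T (within G (suc j) u v)
  back (x~y , d) with m≤n⇒m<n∨m≡n d
  ... | inj₁ (s≤s d≤j) = from T-∨ (inj₁ (from (within-pathsUnion ns j u v) (x~y , d≤j)))
  ... | inj₂ d≡ with atDistance-split ns (x~y , d≡)
  ...   | w , bound , (x~w , d₁) , edge with fromℕ< (w<sum bound) | toℕ-fromℕ< (w<sum bound)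
  ...     | W | refl = from T-∨ (inj₂ (from (any-allFin⇔ _)
                         (W , from T-∧ (from (within-pathsUnion ns j u W) (x~w , ≤-reflexive d₁) ,
                                        from (adj-pathsUnion ns W v) edge))))

atDist-pathsUnion : ∀ ns k (u v : Fin (sum ns)) →
                    T (atDist (pathsUnion ns) k u v) ⇔ AtDistance ns k (toℕ u) (toℕ v)
atDist-pathsUnion ns zero u v = mk⇔
  (λ t → let (same , d) = to (within-pathsUnion ns 0 u v) t in same , n≤0⇒n≡0 d)
  (λ (same , d) → from (within-pathsUnion ns 0 u v) (same , ≤-reflexive d))
atDist-pathsUnion ns (suc k) u v = mk⇔ forth back
  where
  G : Graph
  G = pathsUnion ns
  forth : T (atDist G (suc k) u v) → AtDistance ns (suc k) (toℕ u) (toℕ v)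
  forth t with to T-∧ t
  ... | near , not-nearer with to (within-pathsUnion ns (suc k) u v) near
  ...   | same , d with m≤n⇒m<n∨m≡n d
  ...     | inj₂ d≡ = same , d≡
  ...     | inj₁ (s≤s d≤k) =
    ⊥-elim (subst T (to T-not-≡ not-nearer) (from (within-pathsUnion ns k u v) (same , d≤k)))
  back : AtDistance ns (suc k) (toℕ u) (toℕ v) → T (atDist G (suc k) u v)
  back (same , d) = from T-∧ (from (within-pathsUnion ns (suc k) u v) (same , ≤-reflexive d) ,
                              from T-not-≡ (¬T⇒≡false nearer))
    where
    ¬T⇒≡false : ∀ {b} → ¬ T b → b ≡ false
    ¬T⇒≡false {true}  ¬t = ⊥-elim (¬t _)
    ¬T⇒≡false {false} _  = refl
    nearer : ¬ T (within G k u v)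
    nearer t = 1+n≰n (subst (_≤ k) d (proj₂ (to (within-pathsUnion ns k u v) t)))

-- Vertices whose k-sphere is a single vertex

SingletonSphere : List ℕ → ℕ → ℕ → ℕ → Set
SingletonSphere ns k x w =
  x < sum ns × w < sum ns × (∀ {y} → y < sum ns → AtDistance ns k x y ⇔ y ≡ w)

singletonSphere-zero : ∀ {ns x} → x < sum ns → SingletonSphere ns 0 x x
singletonSphere-zero {x = x} x< = x< , x< , λ _ →
  mk⇔ (λ (_ , d) → sym (∣m-n∣≡0⇒m≡n d)) (λ { refl → refl , ∣n-n∣≡0 x })

module _ {ns a n} (B : Block ns a n) where
  open Block B

  atDistance-inBlock : ∀ {k x y} → a ≤ x → x < a + n → y < sum ns →
                       AtDistance ns k x y ⇔ (a ≤ y × y < a + n × ∣ x - y ∣ ≡ k)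
  atDistance-inBlock {k} {x} {y} a≤x x< y< = mk⇔ forth back
    where
    x~a : SameBlock ns x a
    x~a = from (members (<-≤-trans x< bounded)) (a≤x , x<)
    forth : AtDistance ns k x y → a ≤ y × y < a + n × ∣ x - y ∣ ≡ k
    forth (x~y , d) = let (a≤y , y<) = to (members y<) (trans (sym x~y) x~a) in a≤y , y< , d
    back : a ≤ y × y < a + n × ∣ x - y ∣ ≡ k → AtDistance ns k x y
    back (a≤y , y<a+n , d) = trans x~a (sym (from (members y<) (a≤y , y<a+n))) , d

  singletonSphere-rightward : ∀ {k i} → i < k → i + k < n →
                              SingletonSphere ns k (a + i) (a + i + k)
  singletonSphere-rightward {k} {i} i<k i+k<n =
    <-≤-trans x<a+n bounded , <-≤-trans w<a+n bounded , λ y< →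
    mk⇔ (λ d → partner (to (atDistance-inBlock (m≤m+n a i) x<a+n y<) d))
        (λ { refl → from (atDistance-inBlock (m≤m+n a i) x<a+n y<)
                      (≤-trans (m≤m+n a i) (m≤m+n (a + i) k) , w<a+n , ∣m-m+n∣≡n (a + i) k) })
    where
    x<a+n : a + i < a + n
    x<a+n = +-monoʳ-< a (≤-<-trans (m≤m+n i k) i+k<n)
    w<a+n : a + i + k < a + n
    w<a+n = subst (_< a + n) (sym (+-assoc a i k)) (+-monoʳ-< a i+k<n)
    partner : ∀ {y} → a ≤ y × y < a + n × ∣ a + i - y ∣ ≡ k → y ≡ a + i + k
    partner {y} (a≤y , _ , d) with to (∣m-n∣≡k⇔ {a + i} {y}) d
    ... | inj₁ x+k≡y = sym x+k≡y
    ... | inj₂ y+k≡x =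
      ⊥-elim (<⇒≱ i<k (+-cancelˡ-≤ a k i (≤-trans (+-monoˡ-≤ k a≤y) (≤-reflexive y+k≡x))))

  singletonSphere-leftward : ∀ {k j} → j + k < n → n ≤ j + k + k →
                             SingletonSphere ns k (a + j + k) (a + j)
  singletonSphere-leftward {k} {j} j+k<n n≤j+k+k =
    <-≤-trans x<a+n bounded , <-≤-trans w<a+n bounded , λ y< →
    mk⇔ (λ d → partner (to (atDistance-inBlock a≤x x<a+n y<) d))
        (λ { refl → from (atDistance-inBlock a≤x x<a+n y<)
                      (m≤m+n a j , w<a+n , from (∣m-n∣≡k⇔ {a + j + k} {a + j}) (inj₂ refl)) })
    where
    a≤x : a ≤ a + j + k
    a≤x = ≤-trans (m≤m+n a j) (m≤m+n (a + j) k)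
    x<a+n : a + j + k < a + n
    x<a+n = subst (_< a + n) (sym (+-assoc a j k)) (+-monoʳ-< a j+k<n)
    w<a+n : a + j < a + n
    w<a+n = ≤-<-trans (m≤m+n (a + j) k) x<a+n
    partner : ∀ {y} → a ≤ y × y < a + n × ∣ a + j + k - y ∣ ≡ k → y ≡ a + j
    partner {y} (_ , y< , d) with to (∣m-n∣≡k⇔ {a + j + k} {y}) d
    ... | inj₂ y+k≡x = +-cancelʳ-≡ k y (a + j) y+k≡x
    ... | inj₁ refl  = ⊥-elim (<⇒≱ y< (begin
      a + n                ≤⟨ +-monoʳ-≤ a n≤j+k+k ⟩
      a + (j + k + k)      ≡⟨ sym (+-assoc a (j + k) k) ⟩
      a + (j + k) + k      ≡⟨ cong (_+ k) (sym (+-assoc a j k)) ⟩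
      a + j + k + k        ∎))
      where open ≤-Reasoning

module _ {ns k f M} (dml : IsKDML (pathsUnion ns) k f M) where
  private
    G : Graph
    G = pathsUnion ns
    label : Fin (sum ns) → ℕ
    label v = suc (toℕ (f v))

  singletonSphere⇒label≡M : ∀ {x w} → SingletonSphere ns k x w →
                            ∃ λ (W : Fin (sum ns)) → toℕ W ≡ w × label W ≡ M
  singletonSphere⇒label≡M (x< , w< , sphere)
    with fromℕ< x< | toℕ-fromℕ< x< | fromℕ< w< | toℕ-fromℕ< w<
  ... | X | refl | W | refl = W , refl , (begin
    label W               ≡⟨ sum-allFin-indicator (atDist G k X) label W sphere-X ⟨
    sphereSum G label k X ≡⟨ proj₂ dml X (W , from (sphere-X W) refl) ⟩
    M                     ∎)
    where
    open ≡-Reasoning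
    sphere-X : ∀ v → T (atDist G k X v) ⇔ v ≡ W
    sphere-X v =
      mk⇔ (λ t → toℕ-injective (to (sphere (toℕ<n v)) (to (atDist-pathsUnion ns k X v) t)))
          (λ { refl → from (atDist-pathsUnion ns k X W) (from (sphere w<) refl) })

  singletonSphere-unique : ∀ {x w x′ w′} →
                           SingletonSphere ns k x w → SingletonSphere ns k x′ w′ → w ≡ w′
  singletonSphere-unique s s′ with singletonSphere⇒label≡M s | singletonSphere⇒label≡M s′
  ... | W , refl , W↦M | W′ , refl , W′↦M =
    cong toℕ (proj₁ (proj₁ dml) (toℕ-injective (suc-injective (trans W↦M (sym W′↦M)))))

  block-length : ∀ {a n} → Block ns a n → 0 < k → k < n → n ≡ suc (k + k)
  block-length {a} {suc m} B k>0 (s≤s k≤m) with m≤n⇒∃[o]m+o≡n k≤m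
  ... | j , refl = cong (λ i → suc (k + i)) j≡k
    where
    j+k≡k+j : j + k ≡ k + j
    j+k≡k+j = +-comm j k
    start : SingletonSphere ns k (a + 0) (a + 0 + k)
    start = singletonSphere-rightward B k>0 (s≤s (m≤m+n k j))
    end : SingletonSphere ns k (a + j + k) (a + j)
    end = singletonSphere-leftward B (s≤s (≤-reflexive j+k≡k+j))
            (subst (_≤ j + k + k) (cong suc j+k≡k+j) (m<m+n (j + k) k>0))
    j≡k : j ≡ k
    j≡k = +-cancelˡ-≡ a j k (sym (trans (cong (_+ k) (sym (+-identityʳ a)))
                                        (singletonSphere-unique start end)))

blockAtDistance : ∀ {ns k} → All (0 <_) ns → ∀ {u v} → T (atDist (pathsUnion ns) k u v) →
                  ∃₂ λ a n → Block ns a n × k < n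
blockAtDistance {ns} {k} pos {u} {v} uv with blockOf pos (toℕ<n u)
... | a , n , B , a≤x , x<a+n
  with to (atDistance-inBlock B a≤x x<a+n (toℕ<n v)) (to (atDist-pathsUnion ns k u v) uv)
... | a≤y , y<a+n , refl = a , n , B , ∣-∣<-interval a≤x x<a+n a≤y y<a+n

¬0-DML : ∀ {ns f M} → 2 ≤ sum ns → ¬ IsKDML (pathsUnion ns) 0 f M
¬0-DML {ns} 2≤ dml =
  0≢1+n (singletonSphere-unique dml (singletonSphere-zero {ns} {0} (<-≤-trans z<s 2≤))
                                    (singletonSphere-zero {ns} {1} 2≤))

¬DML-k≥2 : ∀ {ns k f M} → All (0 <_) ns → 2 ≤ k →
           ∃₂ (λ u v → T (atDist (pathsUnion ns) k u v)) → ¬ IsKDML (pathsUnion ns) k f M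
¬DML-k≥2 {ns} {k} pos 2≤k (u , v , uv) dml = impossible (blockAtDistance pos uv)
  where
  k>0 : 0 < k
  k>0 = <-trans z<s 2≤k
  impossible : ∃₂ (λ a n → Block ns a n × k < n) → ⊥
  impossible (a , n , B , k<n) with block-length dml B k>0 k<n
  ... | refl = 0≢1+n (+-cancelˡ-≡ a 0 1 (+-cancelʳ-≡ k (a + 0) (a + 1)
    (singletonSphere-unique dml (singletonSphere-rightward B k>0 (s≤s (m≤m+n k k)))
                                (singletonSphere-rightward B 2≤k (s≤s (+-monoˡ-≤ k k>0))))))

1-DML⇒P₃ : ∀ {ns f M} → All (2 ≤_) ns → 3 ≤ sum ns → IsKDML (pathsUnion ns) 1 f M →
           ns ≡ 3 ∷ []
1-DML⇒P₃ {[]} _ () _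
1-DML⇒P₃ {m ∷ []} (2≤m ∷ []) _ dml =
  cong (_∷ []) (block-length dml (firstBlock m [] (<-≤-trans z<s 2≤m)) z<s 2≤m)
1-DML⇒P₃ {m ∷ m′ ∷ ns} (2≤m ∷ 2≤m′ ∷ _) _ dml = ⊥-elim (<⇒≱ 2≤m (≤-trans (≤-reflexive m≡0) z≤n))
  where
  m>0 : 0 < m
  m>0 = <-≤-trans z<s 2≤m
  first : Block (m ∷ m′ ∷ ns) 0 m
  first = firstBlock m (m′ ∷ ns) m>0
  second : Block (m ∷ m′ ∷ ns) (m + 0) m′
  second = shiftBlock m m>0 (firstBlock m′ ns (<-≤-trans z<s 2≤m′))
  same-partner : 1 ≡ m + 0 + 0 + 1
  same-partner = singletonSphere-unique dml (singletonSphere-rightward first z<s 2≤m)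
                                            (singletonSphere-rightward second z<s 2≤m′)
  m≡0 : m ≡ 0
  m≡0 = sym (trans (+-cancelʳ-≡ 1 0 (m + 0 + 0) same-partner)
                   (trans (+-identityʳ (m + 0)) (+-identityʳ m)))

kDM⇒P₃∧k≡1 : ∀ {ns k} → All (2 ≤_) ns → KDM (pathsUnion ns) k → ns ≡ 3 ∷ [] × k ≡ 1
kDM⇒P₃∧k≡1 {ns} {zero} _ (3≤ , _ , _ , _ , dml) =
  ⊥-elim (¬0-DML {ns} (≤-trans (n≤1+n 2) 3≤) dml)
kDM⇒P₃∧k≡1 {ns} {1} long (3≤ , _ , _ , _ , dml) = 1-DML⇒P₃ {ns} long 3≤ dml , refl
kDM⇒P₃∧k≡1 {ns} {suc (suc k)} long (_ , pair , _ , _ , dml) =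
  ⊥-elim (¬DML-k≥2 {ns} {suc (suc k)} (All.map (<-≤-trans z<s) long) (s≤s (s≤s z≤n)) pair dml)

-- Labels 1, 3, 2 along the path (stored as 0, 2, 1): every open neighbourhood sums to 3.
P₃-labelling : Fin 3 → Fin 3
P₃-labelling fzero               = fzero
P₃-labelling (fsuc fzero)        = fsuc (fsuc fzero)
P₃-labelling (fsuc (fsuc fzero)) = fsuc fzero

P₃-labelling-involutive : ∀ i → P₃-labelling (P₃-labelling i) ≡ i
P₃-labelling-involutive fzero               = refl
P₃-labelling-involutive (fsuc fzero)        = refl
P₃-labelling-involutive (fsuc (fsuc fzero)) = refl

P₃-1-DM : KDM (pathsUnion (3 ∷ [])) 1
P₃-1-DM = ≤-refl , (fzero , fsuc fzero , _) , P₃-labelling , 3 , bijective , magic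
  where
  bijective : Bijective _≡_ _≡_ P₃-labelling
  bijective = inverseᵇ⇒bijective
    ( strictlyInverseˡ⇒inverseˡ P₃-labelling P₃-labelling-involutive
    , strictlyInverseʳ⇒inverseʳ P₃-labelling P₃-labelling-involutive)
  magic : ∀ u → ∃ (λ w → T (atDist (pathsUnion (3 ∷ [])) 1 u w)) →
          sphereSum (pathsUnion (3 ∷ [])) (λ w → suc (toℕ (P₃-labelling w))) 1 u ≡ 3
  magic fzero               _ = refl
  magic (fsuc fzero)        _ = refl
  magic (fsuc (fsuc fzero)) _ = refl

theorem2p2 : (ns : List ℕ) (k : ℕ) → All (λ n → 2 ≤ n) ns →
    KDM (pathsUnion ns) k ⇔ (All (λ n → n ≡ 3) ns × length ns ≡ 1 × k ≡ 1)
theorem2p2 ns k long = mk⇔ forward backward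
  where
  forward : KDM (pathsUnion ns) k → All (λ n → n ≡ 3) ns × length ns ≡ 1 × k ≡ 1
  forward dm with kDM⇒P₃∧k≡1 long dm
  ... | ns≡P₃ , k≡1 = let (all≡3 , length≡1) = from allEqual∧length≡1⇔ ns≡P₃
                      in all≡3 , length≡1 , k≡1
  backward : All (λ n → n ≡ 3) ns × length ns ≡ 1 × k ≡ 1 → KDM (pathsUnion ns) k
  backward (all≡3 , length≡1 , k≡1) =
    subst₂ (λ ns k → KDM (pathsUnion ns) k)
           (sym (to allEqual∧length≡1⇔ (all≡3 , length≡1))) (sym k≡1) P₃-1-DM
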